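{- Let $\mathbf A$ be a Stonean residuated lattice. Then every admissible subalgebra $\mathbf S$ of $K(\mathbf A)$ is good, i.e. for all $a,b\in A$, if $(\neg\neg a,\neg\neg b)\in S$ then $(a,b)\in S$.
   Context: A bounded commutative residuated lattice is $(A,\vee,\wedge,\cdot,\to,0,1)$ with $(A,\vee,\wedge)$ a lattice, $(A,\cdot,1)$ a commutative monoid, $ab\le c$ iff $a\le b\to c$, $1$ greatest, $0$ least; $\neg x:=x\to0$; it is Stonean if it satisfies $\neg x\vee\neg\neg x=1$. $K(\mathbf A)$ is the algebra on $A\times A$ with $(a,b)\vee(c,d)=(a\vee c,b\wedge d)$, $(a,b)\wedge(c,d)=(a\wedge c,b\vee d)$, $(a,b)(c,d)=(ac,(a\to d)\wedge(c\to b))$, $(a,b)\to(c,d)=((a\to c)\wedge(d\to b),ad)$, unit $(1,1)$, constant $0$ as $(0,1)$. A subalgebra $\mathbf S$ of $K(\mathbf A)$ is admissible if the elements of $S$ below $(1,1)$ are exactly all $(a,1)$, $a\in A$. -}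

module Defs where

open import Level using (Level; suc; _⊔_)
open import Data.Product using (_×_; _,_; proj₁; proj₂)
open import Relation.Binary.PropositionalEquality using (_≡_)

record BCRL (a : Level) : Set (suc a) where
  infixr 5 _⇒_
  infixl 7 _·_
  infixl 6 _∧_
  infixl 5 _∨_
  infix 4 _≤_
  field
    Carrier : Set a
    _∨_ _∧_ _·_ _⇒_ : Carrier → Carrier → Carrier
    𝟘 𝟙 : Carrier
    ∨-comm   : ∀ x y → x ∨ y ≡ y ∨ x
    ∧-comm   : ∀ x y → x ∧ y ≡ y ∧ x
    ∨-assoc  : ∀ x y z → (x ∨ y) ∨ z ≡ x ∨ (y ∨ z)
    ∧-assoc  : ∀ x y z → (x ∧ y) ∧ z ≡ x ∧ (y ∧ z)
    ∨-absorbs-∧ : ∀ x y → x ∨ (x ∧ y) ≡ x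
    ∧-absorbs-∨ : ∀ x y → x ∧ (x ∨ y) ≡ x
    ·-comm   : ∀ x y → x · y ≡ y · x
    ·-assoc  : ∀ x y z → (x · y) · z ≡ x · (y · z)
    ·-identityˡ : ∀ x → 𝟙 · x ≡ x
  _≤_ : Carrier → Carrier → Set a
  x ≤ y = x ∧ y ≡ x
  field
    residuation₁ : ∀ x y z → x · y ≤ z → x ≤ y ⇒ z
    residuation₂ : ∀ x y z → x ≤ y ⇒ z → x · y ≤ z
    𝟙-top : ∀ x → x ≤ 𝟙
    𝟘-bot : ∀ x → 𝟘 ≤ x

  ¬_ : Carrier → Carrier
  ¬ x = x ⇒ 𝟘

Stonean : ∀ {a} → BCRL a → Set a
Stonean A = ∀ x → (¬ x) ∨ (¬ (¬ x)) ≡ 𝟙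
  where open BCRL A

module K {a} (A : BCRL a) where
  open BCRL A

  KA : Set a
  KA = Carrier × Carrier

  _∨K_ : KA → KA → KA
  (x , y) ∨K (z , w) = (x ∨ z , y ∧ w)

  _∧K_ : KA → KA → KA
  (x , y) ∧K (z , w) = (x ∧ z , y ∨ w)

  _·K_ : KA → KA → KA
  (x , y) ·K (z , w) = (x · z , (x ⇒ w) ∧ (z ⇒ y))

  _⇒K_ : KA → KA → KA
  (x , y) ⇒K (z , w) = ((x ⇒ z) ∧ (w ⇒ y) , x · w)

  𝟙K : KA
  𝟙K = (𝟙 , 𝟙)

  𝟘K : KA
  𝟘K = (𝟘 , 𝟙)

  _≤K_ : KA → KA → Set a
  s ≤K t = s ∧K t ≡ s

  record IsSubalgebra (S : KA → Set a) : Set a where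
    field
      ∨-closed : ∀ {s t} → S s → S t → S (s ∨K t)
      ∧-closed : ∀ {s t} → S s → S t → S (s ∧K t)
      ·-closed : ∀ {s t} → S s → S t → S (s ·K t)
      ⇒-closed : ∀ {s t} → S s → S t → S (s ⇒K t)
      𝟙-mem    : S 𝟙K
      𝟘-mem    : S 𝟘K

  Admissible : (KA → Set a) → Set a
  Admissible S = IsSubalgebra S
               × (∀ s → S s → s ≤K 𝟙K → proj₂ s ≡ 𝟙)
               × (∀ x → S (x , 𝟙))

  Good : (KA → Set a) → Set a
  Good S = ∀ x y → S (¬ (¬ x) , ¬ (¬ y)) → S (x , y)

-- In a Stonean residuated lattice every z splits as z·¬c ∨ z·¬¬c. Hence
-- ¬c ∧ ¬¬c = 0, and x is recovered from ¬¬x as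
-- (¬¬x ∨ ¬y) ∧ (¬¬x → x) ∧ (¬x → ¬¬y). Admissibility puts (x, 1) and
-- (y, 1) in S, so S also contains their negations (¬y, y) and, negating
-- twice, (x, ¬x). With s = (¬¬x, ¬¬y) the first coordinate of
-- (s ∨ (¬y, y)) ∧ (s → (x, ¬x)) is that expression for x, and the second-coordinate
-- is (¬¬y ∧ y) ∨ ¬¬x·¬x = y.
module Submission where

open import Level using (Level)
open import Data.Product using (_,_; proj₁; proj₂)
open import Relation.Binary.PropositionalEquality using (_≡_; sym; trans; cong; cong₂; subst; isEquivalence; module ≡-Reasoning)
open import Algebra.Lattice.Bundles using (Lattice)
import Algebra.Lattice.Properties.Lattice as LatticeProperties
import Relation.Binary.Lattice as OrderTheoretic
import Relation.Binary.Reasoning.PartialOrder as ≤-Reasoning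
open import Defs

module ResiduatedLatticeProperties {a : Level} (A : BCRL a) where
  open BCRL A hiding (_≤_)

  lattice : Lattice a a
  lattice = record
    { isLattice = record
      { isEquivalence = isEquivalence
      ; ∨-comm        = ∨-comm
      ; ∨-assoc       = ∨-assoc
      ; ∨-cong        = cong₂ _∨_
      ; ∧-comm        = ∧-comm
      ; ∧-assoc       = ∧-assoc
      ; ∧-cong        = cong₂ _∧_
      ; absorptive    = ∨-absorbs-∧ , ∧-absorbs-∨
      }
    }

  open LatticeProperties lattice public using (poset)
  open OrderTheoretic.Lattice (LatticeProperties.∨-∧-orderTheoreticLattice lattice) public
    using (_≤_; antisym; x∧y≤x; x∧y≤y; ∧-greatest; x≤x∨y; y≤x∨y; ∨-least)
    renaming (refl to ≤-refl; trans to ≤-trans)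
  open ≤-Reasoning poset

  -- The library order is x ≡ x ∧ y, the field BCRL._≤_ is x ∧ y ≡ x.
  residuate : ∀ {x y z} → x · y ≤ z → x ≤ y ⇒ z
  residuate p = sym (residuation₁ _ _ _ (sym p))

  unresiduate : ∀ {x y z} → x ≤ y ⇒ z → x · y ≤ z
  unresiduate p = sym (residuation₂ _ _ _ (sym p))

  x≤𝟙 : ∀ x → x ≤ 𝟙
  x≤𝟙 x = sym (𝟙-top x)

  𝟘≤x : ∀ x → 𝟘 ≤ x
  𝟘≤x x = sym (𝟘-bot x)

  x≤𝟘⇒x≡𝟘 : ∀ {x} → x ≤ 𝟘 → x ≡ 𝟘
  x≤𝟘⇒x≡𝟘 p = antisym p (𝟘≤x _)

  ·-identityʳ : ∀ x → x · 𝟙 ≡ x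
  ·-identityʳ x = trans (·-comm x 𝟙) (·-identityˡ x)

  modus-ponens : ∀ x y → (x ⇒ y) · x ≤ y
  modus-ponens x y = unresiduate ≤-refl

  ·-monoˡ-≤ : ∀ {x y} z → x ≤ y → x · z ≤ y · z
  ·-monoˡ-≤ z x≤y = unresiduate (≤-trans x≤y (residuate ≤-refl))

  x·y≤x : ∀ x y → x · y ≤ x
  x·y≤x x y = begin
    x · y ≡⟨ ·-comm x y ⟩
    y · x ≤⟨ ·-monoˡ-≤ x (x≤𝟙 y) ⟩
    𝟙 · x ≡⟨ ·-identityˡ x ⟩
    x     ∎

  ·-distribʳ-∨ : ∀ x y z → (x ∨ y) · z ≡ x · z ∨ y · z
  ·-distribʳ-∨ x y z = antisym
    (unresiduate (∨-least (residuate (x≤x∨y _ _)) (residuate (y≤x∨y _ _))))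
    (∨-least (·-monoˡ-≤ z (x≤x∨y x y)) (·-monoˡ-≤ z (y≤x∨y x y)))

  ·-distribˡ-∨ : ∀ x y z → x · (y ∨ z) ≡ x · y ∨ x · z
  ·-distribˡ-∨ x y z = begin-equality
    x · (y ∨ z)     ≡⟨ ·-comm x _ ⟩
    (y ∨ z) · x     ≡⟨ ·-distribʳ-∨ y z x ⟩
    y · x ∨ z · x   ≡⟨ cong₂ _∨_ (·-comm y x) (·-comm z x) ⟩
    x · y ∨ x · z   ∎

  𝟙⇒x≡x : ∀ x → 𝟙 ⇒ x ≡ x
  𝟙⇒x≡x x = antisym
    (begin
      𝟙 ⇒ x       ≡⟨ ·-identityʳ _ ⟨
      (𝟙 ⇒ x) · 𝟙 ≤⟨ modus-ponens 𝟙 x ⟩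
      x           ∎)
    (residuate (begin
      x · 𝟙 ≡⟨ ·-identityʳ x ⟩
      x     ∎))

  x·¬x≤𝟘 : ∀ x → x · ¬ x ≤ 𝟘
  x·¬x≤𝟘 x = begin
    x · ¬ x ≡⟨ ·-comm x _ ⟩
    ¬ x · x ≤⟨ modus-ponens x 𝟘 ⟩
    𝟘       ∎

  x≤¬¬x : ∀ x → x ≤ ¬ ¬ x
  x≤¬¬x x = residuate (x·¬x≤𝟘 x)

  ¬¬x∧x≡x : ∀ x → ¬ ¬ x ∧ x ≡ x
  ¬¬x∧x≡x x = trans (∧-comm _ _) (sym (x≤¬¬x x))

  ¬¬x·¬x≡𝟘 : ∀ x → ¬ ¬ x · ¬ x ≡ 𝟘
  ¬¬x·¬x≡𝟘 x = x≤𝟘⇒x≡𝟘 (modus-ponens (¬ x) 𝟘)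

  x∨𝟘≡x : ∀ x → x ∨ 𝟘 ≡ x
  x∨𝟘≡x x = antisym (∨-least ≤-refl (𝟘≤x x)) (x≤x∨y x 𝟘)

module StoneanProperties {a : Level} (A : BCRL a) (stonean : Stonean A) where
  open BCRL A hiding (_≤_)
  open ResiduatedLatticeProperties A
  open ≤-Reasoning poset

  split-¬ : ∀ c z → z ≡ z · ¬ c ∨ z · ¬ ¬ c
  split-¬ c z = begin-equality
    z                     ≡⟨ ·-identityʳ z ⟨
    z · 𝟙                 ≡⟨ cong (z ·_) (stonean c) ⟨
    z · (¬ c ∨ ¬ ¬ c)     ≡⟨ ·-distribˡ-∨ z _ _ ⟩
    z · ¬ c ∨ z · ¬ ¬ c   ∎

  ¬x∧¬¬x≡𝟘 : ∀ x → ¬ x ∧ ¬ ¬ x ≡ 𝟘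
  ¬x∧¬¬x≡𝟘 x = x≤𝟘⇒x≡𝟘 (begin
    z                     ≡⟨ split-¬ x z ⟩
    z · ¬ x ∨ z · ¬ ¬ x   ≤⟨ ∨-least z·¬x≤𝟘 z·¬¬x≤𝟘 ⟩
    𝟘                     ∎)
    where
    z : Carrier
    z = ¬ x ∧ ¬ ¬ x

    z·¬x≤𝟘 : z · ¬ x ≤ 𝟘
    z·¬x≤𝟘 = begin
      z · ¬ x     ≤⟨ ·-monoˡ-≤ (¬ x) (x∧y≤y _ _) ⟩
      ¬ ¬ x · ¬ x ≤⟨ modus-ponens (¬ x) 𝟘 ⟩
      𝟘           ∎

    z·¬¬x≤𝟘 : z · ¬ ¬ x ≤ 𝟘
    z·¬¬x≤𝟘 = begin
      z · ¬ ¬ x   ≤⟨ ·-monoˡ-≤ (¬ ¬ x) (x∧y≤x _ _) ⟩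
      ¬ x · ¬ ¬ x ≤⟨ x·¬x≤𝟘 (¬ x) ⟩
      𝟘           ∎

  recover-from-¬¬ : ∀ x y → (¬ ¬ x ∨ ¬ y) ∧ ((¬ ¬ x ⇒ x) ∧ (¬ x ⇒ ¬ ¬ y)) ≡ x
  recover-from-¬¬ x y = antisym f≤x x≤f
    where
    f : Carrier
    f = (¬ ¬ x ∨ ¬ y) ∧ ((¬ ¬ x ⇒ x) ∧ (¬ x ⇒ ¬ ¬ y))

    f·¬x≤¬y : f · ¬ x ≤ ¬ y
    f·¬x≤¬y = begin
      f · ¬ x                   ≤⟨ ·-monoˡ-≤ (¬ x) (x∧y≤x _ _) ⟩
      (¬ ¬ x ∨ ¬ y) · ¬ x       ≡⟨ ·-distribʳ-∨ _ _ _ ⟩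
      ¬ ¬ x · ¬ x ∨ ¬ y · ¬ x   ≤⟨ ∨-least (≤-trans (modus-ponens (¬ x) 𝟘) (𝟘≤x _)) (x·y≤x _ _) ⟩
      ¬ y                       ∎

    f·¬x≤¬¬y : f · ¬ x ≤ ¬ ¬ y
    f·¬x≤¬¬y = unresiduate (≤-trans (x∧y≤y _ _) (x∧y≤y _ _))

    f·¬¬x≤x : f · ¬ ¬ x ≤ x
    f·¬¬x≤x = unresiduate (≤-trans (x∧y≤y _ _) (x∧y≤x _ _))

    f·¬x≤𝟘 : f · ¬ x ≤ 𝟘
    f·¬x≤𝟘 = begin
      f · ¬ x      ≤⟨ ∧-greatest f·¬x≤¬y f·¬x≤¬¬y ⟩
      ¬ y ∧ ¬ ¬ y  ≡⟨ ¬x∧¬¬x≡𝟘 y ⟩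
      𝟘            ∎

    f≤x : f ≤ x
    f≤x = begin
      f                     ≡⟨ split-¬ x f ⟩
      f · ¬ x ∨ f · ¬ ¬ x   ≤⟨ ∨-least (≤-trans f·¬x≤𝟘 (𝟘≤x x)) f·¬¬x≤x ⟩
      x                     ∎

    x≤f : x ≤ f
    x≤f = ∧-greatest (≤-trans (x≤¬¬x x) (x≤x∨y _ _))
            (∧-greatest (residuate (x·y≤x x _))
                        (residuate (≤-trans (x·¬x≤𝟘 x) (𝟘≤x _))))

module AdmissibleProperties {a : Level} (A : BCRL a) where
  open BCRL A hiding (_≤_)
  open K A
  open ResiduatedLatticeProperties A

  ¬K_ : KA → KA
  ¬K s = s ⇒K 𝟘K

  ¬K-pair : ∀ x y → ¬K (x , y) ≡ (¬ x ∧ y , x)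
  ¬K-pair x y = cong₂ _,_ (cong (¬ x ∧_) (𝟙⇒x≡x y)) (·-identityʳ x)

  module _ {S : KA → Set a} (admissible : Admissible S) where
    open IsSubalgebra (proj₁ admissible)

    ¬x,x∈S : ∀ x → S (¬ x , x)
    ¬x,x∈S x = subst S (trans (¬K-pair x 𝟙) (cong (_, x) (sym (x≤𝟙 (¬ x)))))
                       (⇒-closed (proj₂ (proj₂ admissible) x) 𝟘-mem)

    x,¬x∈S : ∀ x → S (x , ¬ x)
    x,¬x∈S x = subst S (trans (¬K-pair (¬ x) x) (cong (_, ¬ x) (¬¬x∧x≡x x)))
                       (⇒-closed (¬x,x∈S x) 𝟘-mem)

lemma3p10 : ∀ {a : Level} (A : BCRL a) → Stonean A →
    (S : K.KA A → Set a) → K.Admissible A S → K.Good A S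
lemma3p10 A stonean S admissible x y s∈S =
  subst S (cong₂ _,_ (recover-from-¬¬ x y) second-coordinate)
    (∧-closed (∨-closed s∈S (¬x,x∈S admissible y)) (⇒-closed s∈S (x,¬x∈S admissible x)))
  where
  open BCRL A hiding (_≤_)
  open K A
  open ResiduatedLatticeProperties A
  open StoneanProperties A stonean
  open AdmissibleProperties A
  open IsSubalgebra (proj₁ admissible)
  open ≡-Reasoning
  second-coordinate : ¬ ¬ y ∧ y ∨ ¬ ¬ x · ¬ x ≡ y
  second-coordinate = begin
    ¬ ¬ y ∧ y ∨ ¬ ¬ x · ¬ x   ≡⟨ cong₂ _∨_ (¬¬x∧x≡x y) (¬¬x·¬x≡𝟘 x) ⟩
    y ∨ 𝟘                     ≡⟨ x∨𝟘≡x y ⟩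
    y                         ∎
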